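{- Let $S$ be a string, $a$ a character and $x$ a string. If $x \notin \mathsf{M}(aS)$ and $x \in \mathsf{M}(S)$, then $x \in \mathrm{Prefix}(S)$, $ax \in \mathsf{M}(aS)$, and $d_S(x) = d_{aS}(ax)$.
   Context: Strings are finite sequences of characters from an alphabet $\Sigma$; $\varepsilon$ is the empty string. For a string $T$, $\mathrm{Substr}(T)$ and $\mathrm{Prefix}(T)$ are its sets of substrings and prefixes (including $\varepsilon$). A substring $u$ of $T$ is left-maximal in $T$ if $u$ is a prefix of $T$ or there are distinct characters $c \neq d$ with $cu, du \in \mathrm{Substr}(T)$; it is right-maximal in $T$ if $u$ is a suffix of $T$ or there are distinct characters $c\neq d$ with $uc, ud \in \mathrm{Substr}(T)$. $\mathsf{M}(T)$ is the set of substrings of $T$ that are both left- and right-maximal. For a string $w$, $d_T(w)$ is the number of distinct characters $c$ with $wc \in \mathrm{Substr}(T)$. -}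

module Defs where

open import Data.List using (List; []; _∷_; _++_; [_]; length; deduplicate)
open import Data.Product using (∃; ∃-syntax; _×_; _,_)
open import Data.Sum using (_⊎_)
open import Data.Maybe using (Maybe; just; nothing)
open import Data.Nat using (ℕ)
open import Relation.Nullary using (¬_; yes; no)
open import Relation.Binary.Definitions using (DecidableEquality)
open import Relation.Binary.PropositionalEquality using (_≡_)

module Strings {A : Set} (_≟_ : DecidableEquality A) where

  Substr : List A → List A → Set
  Substr T u = ∃[ l ] ∃[ r ] T ≡ l ++ u ++ r

  Prefix : List A → List A → Set
  Prefix T u = ∃[ r ] T ≡ u ++ r

  Suffix : List A → List A → Set
  Suffix T u = ∃[ l ] T ≡ l ++ u

  LeftMaximal : List A → List A → Set
  LeftMaximal T u = Substr T u ×
    (Prefix T u ⊎ ∃[ c ] ∃[ d ] (¬ c ≡ d × Substr T (c ∷ u) × Substr T (d ∷ u)))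

  RightMaximal : List A → List A → Set
  RightMaximal T u = Substr T u ×
    (Suffix T u ⊎ ∃[ c ] ∃[ d ] (¬ c ≡ d × Substr T (u ++ [ c ]) × Substr T (u ++ [ d ])))

  M : List A → List A → Set
  M T u = LeftMaximal T u × RightMaximal T u

  nextAfter : List A → List A → Maybe A
  nextAfter []      []      = nothing
  nextAfter []      (c ∷ _) = just c
  nextAfter (_ ∷ _) []      = nothing
  nextAfter (x ∷ w) (y ∷ s) with x ≟ y
  ... | yes _ = nextAfter w s
  ... | no  _ = nothing

  nextChars : List A → List A → List A
  nextChars w [] = []
  nextChars w (t ∷ T) with nextAfter w (t ∷ T)
  ... | just c  = c ∷ nextChars w T
  ... | nothing = nextChars w T

  -- d_T(w): number of distinct characters c with wc ∈ Substr(T)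
  d : List A → List A → ℕ
  d T w = length (deduplicate _≟_ (nextChars w T))

-- If x were left-maximal in S without being a prefix, its two distinct left neighbours would
-- survive in aS, and right-maximality always survives; so x is a prefix of S and is not
-- left-maximal in aS.  All occurrences of a non-left-maximal substring are preceded by the same
-- character, which is a since ax occurs.  Hence every occurrence of x in aS extends to one of ax,
-- carrying over right-maximality and the set of right extensions.
module Submission where

open import Defs
open import Data.List using (List; []; _∷_; _++_; [_]; _∷ʳ_; length; deduplicate; initLast; _∷ʳ′_)
open import Data.List.Properties using (++-assoc; ++-identityʳ; ∷-injectiveʳ)
open import Data.List.Membership.Propositional using (_∈_)
open import Data.List.Membership.Propositional.Properties using (deduplicate-∈⇔)
open import Data.List.Membership.Propositional.Properties.WithK using (unique∧set⇒bag)
open import Data.List.Relation.Binary.BagAndSetEquality using (∼bag⇒↭)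
open import Data.List.Relation.Binary.Permutation.Propositional.Properties using (↭-length)
open import Data.List.Relation.Unary.Any using (here; there)
open import Data.Maybe using (just; nothing)
open import Data.Product using (_×_; _,_; ∃-syntax)
open import Data.Sum using (_⊎_; inj₁; inj₂)
open import Function.Base using (_∘_)
open import Function.Bundles using (_⇔_; mk⇔; Equivalence)
open import Function.Related.Propositional using (SK-sym; module EquationalReasoning)
open import Relation.Nullary using (¬_; yes; no; contradiction)
open import Relation.Binary.Definitions using (DecidableEquality)
open import Relation.Binary.PropositionalEquality using (_≡_; refl; sym; trans; cong)

module _ {A : Set} (_≟_ : DecidableEquality A) where

  open import Data.List.Relation.Unary.Unique.DecPropositional.Properties _≟_ using (deduplicate-!)

  length-deduplicate-cong : {xs ys : List A} → (∀ {c} → c ∈ xs ⇔ c ∈ ys) →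
    length (deduplicate _≟_ xs) ≡ length (deduplicate _≟_ ys)
  length-deduplicate-cong {xs} {ys} xs⇔ys =
    ↭-length (∼bag⇒↭ (unique∧set⇒bag (deduplicate-! xs) (deduplicate-! ys) λ {c} → begin
      c ∈ deduplicate _≟_ xs  ∼⟨ SK-sym (deduplicate-∈⇔ _≟_) ⟩
      c ∈ xs                  ∼⟨ xs⇔ys ⟩
      c ∈ ys                  ∼⟨ deduplicate-∈⇔ _≟_ ⟩
      c ∈ deduplicate _≟_ ys  ∎))
    where open EquationalReasoning

module StringProperties {A : Set} (_≟_ : DecidableEquality A) where

  open Strings _≟_

  Substr-∷⁺ : ∀ {T u} (a : A) → Substr T u → Substr (a ∷ T) u
  Substr-∷⁺ a (l , r , e) = a ∷ l , r , cong (a ∷_) e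

  Substr-∷⁻ : ∀ {T w} {a b : A} → Substr (a ∷ T) (b ∷ w) → Substr T w
  Substr-∷⁻         ([]    , r , refl) = [] , r , refl
  Substr-∷⁻ {b = b} (_ ∷ l , r , refl) = l ++ [ b ] , r , sym (++-assoc l [ b ] _)

  Prefix⇒Substr : ∀ {T u} → Prefix T u → Substr T u
  Prefix⇒Substr (r , e) = [] , r , e

  Prefix⇒LeftMaximal : ∀ {T u} → Prefix T u → LeftMaximal T u
  Prefix⇒LeftMaximal p = Prefix⇒Substr p , inj₁ p

  RightMaximal-∷⁺ : ∀ {T u} (a : A) → RightMaximal T u → RightMaximal (a ∷ T) u
  RightMaximal-∷⁺ a (s , inj₁ (l , e)) = Substr-∷⁺ a s , inj₁ (a ∷ l , cong (a ∷_) e)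
  RightMaximal-∷⁺ a (s , inj₂ (c , d , c≢d , sc , sd)) =
    Substr-∷⁺ a s , inj₂ (c , d , c≢d , Substr-∷⁺ a sc , Substr-∷⁺ a sd)

  LeftMaximal⇒Prefix⊎LeftMaximal-∷ : ∀ {T u} (a : A) → LeftMaximal T u →
    Prefix T u ⊎ LeftMaximal (a ∷ T) u
  LeftMaximal⇒Prefix⊎LeftMaximal-∷ a (s , inj₁ p) = inj₁ p
  LeftMaximal⇒Prefix⊎LeftMaximal-∷ a (s , inj₂ (c , d , c≢d , cs , ds)) =
    inj₂ (Substr-∷⁺ a s , inj₂ (c , d , c≢d , Substr-∷⁺ a cs , Substr-∷⁺ a ds))

  -- Not being left-maximal, u is not a prefix and all its left neighbours coincide.
  occurrence-extendˡ : ∀ {T u c} l v → ¬ LeftMaximal T u → Substr T (c ∷ u) →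
    T ≡ l ++ u ++ v → ∃[ l₀ ] T ≡ l₀ ++ c ∷ u ++ v
  occurrence-extendˡ {c = c} l v ¬lm cu e with initLast l
  ... | [] = contradiction (Prefix⇒LeftMaximal (v , e)) ¬lm
  ... | l₀ ∷ʳ′ b with b ≟ c | trans e (++-assoc l₀ [ b ] _)
  ...   | yes refl | e′ = l₀ , e′
  ...   | no b≢c   | e′ = contradiction ((l₀ ∷ʳ b , v , e) , inj₂ (b , c , b≢c , (l₀ , v , e′) , cu)) ¬lm

  Substr-extendˡ : ∀ {T u c} w → ¬ LeftMaximal T u → Substr T (c ∷ u) →
    Substr T (u ++ w) → Substr T (c ∷ u ++ w)
  Substr-extendˡ {u = u} {c} w ¬lm cu (l , r , e)
    with occurrence-extendˡ l (w ++ r) ¬lm cu (trans e (cong (l ++_) (++-assoc u w r)))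
  ... | l₀ , e′ = l₀ , r , trans e′ (cong (λ z → l₀ ++ c ∷ z) (sym (++-assoc u w r)))

  RightMaximal-extendˡ : ∀ {T u c} → ¬ LeftMaximal T u → Substr T (c ∷ u) →
    RightMaximal T u → RightMaximal T (c ∷ u)
  RightMaximal-extendˡ {u = u} {c} ¬lm cu (_ , inj₁ (l , e))
    with occurrence-extendˡ l [] ¬lm cu (trans e (cong (l ++_) (sym (++-identityʳ u))))
  ... | l₀ , e′ = cu , inj₁ (l₀ , trans e′ (cong (λ z → l₀ ++ c ∷ z) (++-identityʳ u)))
  RightMaximal-extendˡ ¬lm cu (_ , inj₂ (c , d , c≢d , sc , sd)) =
    cu , inj₂ (c , d , c≢d , Substr-extendˡ [ c ] ¬lm cu sc , Substr-extendˡ [ d ] ¬lm cu sd)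

  nextAfter≡just⇒Prefix : ∀ w s {c} → nextAfter w s ≡ just c → Prefix s (w ++ [ c ])
  nextAfter≡just⇒Prefix []      (_ ∷ s) refl = s , refl
  nextAfter≡just⇒Prefix (y ∷ w) (z ∷ s) eq with y ≟ z
  nextAfter≡just⇒Prefix (y ∷ w) (y ∷ s) eq | yes refl with nextAfter≡just⇒Prefix w s eq
  ... | r , e = r , cong (y ∷_) e

  Prefix⇒nextAfter≡just : ∀ w s {c} → Prefix s (w ++ [ c ]) → nextAfter w s ≡ just c
  Prefix⇒nextAfter≡just []      _ (r , refl) = refl
  Prefix⇒nextAfter≡just (y ∷ w) _ (r , refl) with y ≟ y
  ... | yes _  = Prefix⇒nextAfter≡just w _ (r , refl)
  ... | no y≢y = contradiction refl y≢y

  ∈nextChars⇒Substr : ∀ w T {c} → c ∈ nextChars w T → Substr T (w ++ [ c ])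
  ∈nextChars⇒Substr w (t ∷ T) c∈ with nextAfter w (t ∷ T) in eq | c∈
  ... | just _  | here refl = Prefix⇒Substr (nextAfter≡just⇒Prefix w (t ∷ T) eq)
  ... | just _  | there c∈T = Substr-∷⁺ t (∈nextChars⇒Substr w T c∈T)
  ... | nothing | c∈T       = Substr-∷⁺ t (∈nextChars⇒Substr w T c∈T)

  Substr⇒∈nextChars : ∀ w T {c} → Substr T (w ++ [ c ]) → c ∈ nextChars w T
  Substr⇒∈nextChars []      [] ([] , _ , ())
  Substr⇒∈nextChars (_ ∷ _) [] ([] , _ , ())
  Substr⇒∈nextChars w (t ∷ T) ([] , r , e)
    with nextAfter w (t ∷ T) | Prefix⇒nextAfter≡just w (t ∷ T) (r , e)
  ... | just _ | refl = here refl
  Substr⇒∈nextChars w (t ∷ T) (_ ∷ l , r , e) with nextAfter w (t ∷ T)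
  ... | just _  = there (Substr⇒∈nextChars w T (l , r , ∷-injectiveʳ e))
  ... | nothing = Substr⇒∈nextChars w T (l , r , ∷-injectiveʳ e)

  d-cong : ∀ {T T′ w w′} → (∀ c → Substr T (w ++ [ c ]) ⇔ Substr T′ (w′ ++ [ c ])) → d T w ≡ d T′ w′
  d-cong {T} {T′} {w} {w′} ext = length-deduplicate-cong _≟_ λ {c} → mk⇔
    (λ c∈ → Substr⇒∈nextChars w′ T′ (Equivalence.to (ext c) (∈nextChars⇒Substr w T c∈)))
    (λ c∈ → Substr⇒∈nextChars w T (Equivalence.from (ext c) (∈nextChars⇒Substr w′ T′ c∈)))

lemma7 : {A : Set} (_≟_ : DecidableEquality A) (S : List A) (a : A) (x : List A) →
    let open Strings _≟_ in
    ¬ M (a ∷ S) x → M S x →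
    Prefix S x × M (a ∷ S) (a ∷ x) × d S x ≡ d (a ∷ S) (a ∷ x)
lemma7 _≟_ S a x x∉M (lm , rm) =
  prefix , (Prefix⇒LeftMaximal ax-prefix , rm-ax) , d-cong {w′ = a ∷ x} extensions
  where
    open Strings _≟_
    open StringProperties _≟_

    ¬lm : ¬ LeftMaximal (a ∷ S) x
    ¬lm lm′ = x∉M (lm′ , RightMaximal-∷⁺ a rm)

    prefix : Prefix S x
    prefix with LeftMaximal⇒Prefix⊎LeftMaximal-∷ a lm
    ... | inj₁ p   = p
    ... | inj₂ lm′ = contradiction lm′ ¬lm

    ax-prefix : Prefix (a ∷ S) (a ∷ x)
    ax-prefix with prefix
    ... | r , e = r , cong (a ∷_) e

    ax-occurs : Substr (a ∷ S) (a ∷ x)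
    ax-occurs = Prefix⇒Substr ax-prefix

    rm-ax : RightMaximal (a ∷ S) (a ∷ x)
    rm-ax = RightMaximal-extendˡ ¬lm ax-occurs (RightMaximal-∷⁺ a rm)

    extensions : ∀ c → Substr S (x ++ [ c ]) ⇔ Substr (a ∷ S) (a ∷ x ++ [ c ])
    extensions c = mk⇔ (Substr-extendˡ [ c ] ¬lm ax-occurs ∘ Substr-∷⁺ a) Substr-∷⁻
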